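{- For every integer $n\ge 0$, \[ \sum_{k=0}^{n}\binom{n}{k}^2\binom{n+k}{n}\binom{2n+k}{n}=\binom{2n}{n}^3. \]
   Context: $\binom{m}{j}$ is the usual binomial coefficient for integers $m\ge0$, with $\binom{m}{j}=0$ if $j<0$ or $j>m$. -}

module Defs where

open import Data.Nat using (ℕ; zero; suc; _+_)

sumTo : ℕ → (ℕ → ℕ) → ℕ
sumTo zero    f = f zero
sumTo (suc n) f = sumTo n f + f (suc n)

-- Both sides satisfy (n+1)³ a(n+1) = 8 (2n+1)³ a(n) with a(0) = 1. For the
-- right-hand side this is (n+1) C(2n+2,n+1) = 2 (2n+1) C(2n,n). For the sum it
-- comes from Zeilberger's creative telescoping: with F(n,k) the summand, there
-- is a certificate H(n,k) with H(n,0) = 0 = H(n,n+2) and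
--   (n+1)³ F(n+1,k) + H(n,k+1) = 8 (2n+1)³ F(n,k) + H(n,k)   (k ≤ n+1),
-- and summing over k telescopes. The identity is checked termwise through the
-- factorial form F(k+m,k) = (3k+2m)! / (k!³ m!²), which turns every term into a
-- polynomial multiple of F(k+m,k).
module Submission where

open import Defs
open import Data.Nat using (ℕ; zero; suc; _+_; _*_; _^_; _∸_; _≤_; _!; NonZero; z≤n; s≤s)
open import Data.Nat.Properties
open import Data.Nat.Combinatorics using (_C_; nCk≡n!/k![n-k]!; k![n∸k]!∣n!; k>n⇒nCk≡0)
open import Data.Nat.DivMod using (m/n*n≡m)
open import Data.Nat.Tactic.RingSolver using (solve-∀)
open import Algebra.Properties.CommutativeSemigroup +-commutativeSemigroup using (x∙yz≈xz∙y)
open import Algebra.Properties.CommutativeSemigroup *-commutativeSemigroup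
  using () renaming (x∙yz≈y∙xz to x*yz≡y*xz)
open import Data.Product using (_,_)
open import Data.Sum using (inj₁; inj₂)
open import Relation.Binary.PropositionalEquality
open ≡-Reasoning

*-distribˡ-sumTo : ∀ c N (g : ℕ → ℕ) → c * sumTo N g ≡ sumTo N (λ k → c * g k)
*-distribˡ-sumTo c zero    g = refl
*-distribˡ-sumTo c (suc N) g = begin
  c * (sumTo N g + g (suc N))             ≡⟨ *-distribˡ-+ c (sumTo N g) (g (suc N)) ⟩
  c * sumTo N g + c * g (suc N)           ≡⟨ cong (_+ c * g (suc N)) (*-distribˡ-sumTo c N g) ⟩
  sumTo N (λ k → c * g k) + c * g (suc N) ∎

sumTo-telescope : ∀ N (a b h : ℕ → ℕ) → h 0 ≡ 0 →
                  (∀ k → k ≤ N → a k + h (suc k) ≡ b k + h k) →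
                  sumTo N a + h (suc N) ≡ sumTo N b
sumTo-telescope zero    a b h h0≡0 step = begin
  a 0 + h 1  ≡⟨ step 0 z≤n ⟩
  b 0 + h 0  ≡⟨ cong (b 0 +_) h0≡0 ⟩
  b 0 + 0    ≡⟨ +-identityʳ (b 0) ⟩
  b 0        ∎
sumTo-telescope (suc N) a b h h0≡0 step = begin
  sumTo N a + a (suc N) + h (suc (suc N))   ≡⟨ +-assoc (sumTo N a) (a (suc N)) _ ⟩
  sumTo N a + (a (suc N) + h (suc (suc N))) ≡⟨ cong (sumTo N a +_) (step (suc N) ≤-refl) ⟩
  sumTo N a + (b (suc N) + h (suc N))       ≡⟨ x∙yz≈xz∙y (sumTo N a) (b (suc N)) (h (suc N)) ⟩
  sumTo N a + h (suc N) + b (suc N)         ≡⟨ cong (_+ b (suc N)) (sumTo-telescope N a b h h0≡0 step′) ⟩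
  sumTo N b + b (suc N)                     ∎
  where
  step′ : ∀ k → k ≤ N → a k + h (suc k) ≡ b k + h k
  step′ k k≤N = step k (m≤n⇒m≤1+n k≤N)

nCk*k!*m!≡n! : ∀ {n} k m → k + m ≡ n → (n C k) * (k ! * m !) ≡ n !
nCk*k!*m!≡n! k m refl =
  subst (λ j → ((k + m) C k) * (k ! * j !) ≡ (k + m) !) (m+n∸m≡n k m)
    (trans (cong (_* (k ! * (k + m ∸ k) !)) (nCk≡n!/k![n-k]! k≤k+m))
           (m/n*n≡m {{k !* (k + m ∸ k) !≢0}} (k![n∸k]!∣n! k≤k+m)))
  where k≤k+m = m≤m+n k m

summand : ℕ → ℕ → ℕ
summand n k = (n C k) ^ 2 * ((n + k) C n) * ((2 * n + k) C n)

summand-vanishes : ∀ n → summand n (suc n) ≡ 0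
summand-vanishes n =
  cong (λ c → c ^ 2 * ((n + suc n) C n) * ((2 * n + suc n) C n)) (k>n⇒nCk≡0 (n<1+n n))

-- The ring solver does not handle _^_, so local identities spell x ^ 2 as x * (x * 1).
summand*k!³m!²≡! : ∀ {n} k m → k + m ≡ n →
                   summand n k * (k ! * k ! * k ! * (m ! * m !)) ≡ (2 * n + k) !
summand*k!³m!²≡! {n} k m k+m≡n = *-cancelʳ-≡ _ _ (n ! * n ! * (n + k) !) (begin
  summand n k * (k ! * k ! * k ! * (m ! * m !)) * (n ! * n ! * (n + k) !)
    ≡⟨ regroup (n C k) B₁ B₂ (k !) (m !) (n !) ((n + k) !) ⟩
  (n C k) * (k ! * m !) * ((n C k) * (k ! * m !)) * (B₁ * (n ! * k !)) * (B₂ * (n ! * (n + k) !))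
    ≡⟨ cong (λ x → x * x * (B₁ * (n ! * k !)) * (B₂ * (n ! * (n + k) !))) (nCk*k!*m!≡n! k m k+m≡n) ⟩
  n ! * n ! * (B₁ * (n ! * k !)) * (B₂ * (n ! * (n + k) !))
    ≡⟨ cong (λ x → n ! * n ! * x * (B₂ * (n ! * (n + k) !))) (nCk*k!*m!≡n! n k refl) ⟩
  n ! * n ! * (n + k) ! * (B₂ * (n ! * (n + k) !))
    ≡⟨ cong (n ! * n ! * (n + k) ! *_) (nCk*k!*m!≡n! n (n + k) (n+[n+k]≡2n+k n k)) ⟩
  n ! * n ! * (n + k) ! * (2 * n + k) !
    ≡⟨ *-comm (n ! * n ! * (n + k) !) ((2 * n + k) !) ⟩
  (2 * n + k) ! * (n ! * n ! * (n + k) !) ∎)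
  where
  instance _ = m*n≢0 (n ! * n !) ((n + k) !) {{n !* n !≢0}} {{(n + k) !≢0}}
  B₁ = (n + k) C n
  B₂ = (2 * n + k) C n
  regroup : ∀ c b₁ b₂ x y z w →
            c * (c * 1) * b₁ * b₂ * (x * x * x * (y * y)) * (z * z * w)
              ≡ c * (x * y) * (c * (x * y)) * (b₁ * (z * x)) * (b₂ * (z * w))
  regroup = solve-∀
  n+[n+k]≡2n+k : ∀ n k → n + (n + k) ≡ 2 * n + k
  n+[n+k]≡2n+k = solve-∀

k!³m!²≢0 : ∀ k m → NonZero (k ! * k ! * k ! * (m ! * m !))
k!³m!²≢0 k m = m*n≢0 _ _ {{m*n≢0 _ _ {{k !* k !≢0}} {{k !≢0}}}} {{m !* m !≢0}}

summand-suc-n : ∀ {n} k m → k + m ≡ n →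
                suc m * suc m * summand (suc n) k
                  ≡ (2 + (2 * n + k)) * (1 + (2 * n + k)) * summand n k
summand-suc-n {n} k m k+m≡n = *-cancelʳ-≡ _ _ (k ! * k ! * k ! * (m ! * m !)) {{k!³m!²≢0 k m}} (begin
  suc m * suc m * summand (suc n) k * (k ! * k ! * k ! * (m ! * m !))
    ≡⟨ regroup (suc m) (summand (suc n) k) (k !) (m !) ⟩
  summand (suc n) k * (k ! * k ! * k ! * (suc m ! * suc m !))
    ≡⟨ summand*k!³m!²≡! k (suc m) (trans (+-suc k m) (cong suc k+m≡n)) ⟩
  (2 * suc n + k) !
    ≡⟨ cong _! (2[1+n]+k≡2+[2n+k] n k) ⟩
  (2 + N) * ((1 + N) * N !)
    ≡⟨ cong (λ x → (2 + N) * ((1 + N) * x)) (summand*k!³m!²≡! k m k+m≡n) ⟨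
  (2 + N) * ((1 + N) * (summand n k * (k ! * k ! * k ! * (m ! * m !))))
    ≡⟨ reassoc (2 + N) (1 + N) (summand n k) (k ! * k ! * k ! * (m ! * m !)) ⟩
  (2 + N) * (1 + N) * summand n k * (k ! * k ! * k ! * (m ! * m !)) ∎)
  where
  N = 2 * n + k
  regroup : ∀ s t x y → s * s * t * (x * x * x * (y * y)) ≡ t * (x * x * x * (s * y * (s * y)))
  regroup = solve-∀
  2[1+n]+k≡2+[2n+k] : ∀ n k → 2 * suc n + k ≡ 2 + (2 * n + k)
  2[1+n]+k≡2+[2n+k] = solve-∀
  reassoc : ∀ a b t w → a * (b * (t * w)) ≡ a * b * t * w
  reassoc = solve-∀

summand-suc-k : ∀ {n} k m → k + m ≡ n →
                suc k * suc k * suc k * summand (suc n) (suc k)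
                  ≡ (1 + (2 * suc n + k)) * (suc m * suc m) * summand (suc n) k
summand-suc-k {n} k m k+m≡n = *-cancelʳ-≡ _ _ (k ! * k ! * k ! * (m ! * m !)) {{k!³m!²≢0 k m}} (begin
  suc k * suc k * suc k * summand (suc n) (suc k) * (k ! * k ! * k ! * (m ! * m !))
    ≡⟨ regroup (suc k) (summand (suc n) (suc k)) (k !) (m !) ⟩
  summand (suc n) (suc k) * (suc k ! * suc k ! * suc k ! * (m ! * m !))
    ≡⟨ summand*k!³m!²≡! (suc k) m (cong suc k+m≡n) ⟩
  (2 * suc n + suc k) !
    ≡⟨ cong _! (+-suc (2 * suc n) k) ⟩
  (1 + N) * N !
    ≡⟨ cong ((1 + N) *_) (summand*k!³m!²≡! k (suc m) (trans (+-suc k m) (cong suc k+m≡n))) ⟨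
  (1 + N) * (summand (suc n) k * (k ! * k ! * k ! * (suc m ! * suc m !)))
    ≡⟨ regroup′ (1 + N) (suc m) (summand (suc n) k) (k !) (m !) ⟩
  (1 + N) * (suc m * suc m) * summand (suc n) k * (k ! * k ! * k ! * (m ! * m !)) ∎)
  where
  N = 2 * suc n + k
  regroup : ∀ s t x y → s * s * s * t * (x * x * x * (y * y)) ≡ t * (s * x * (s * x) * (s * x) * (y * y))
  regroup = solve-∀
  regroup′ : ∀ a s t x y → a * (t * (x * x * x * (s * y * (s * y)))) ≡ a * (s * s) * t * (x * x * x * (y * y))
  regroup′ = solve-∀

certificateFactor : ℕ → ℕ → ℕ
certificateFactor n r = (3 * n + 2) * (3 * n + 3) + (21 * n + 13) * r

-- Zeilberger's certificate H(n,k). In the range used, n ∸ k truncates only in H(n, n+2),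
-- whose factor F(n, n+1) vanishes.
certificate : ℕ → ℕ → ℕ
certificate n zero    = 0
certificate n (suc k) = certificateFactor n (n ∸ k) * suc (2 * n + k) * summand n k

certificate-vanishes : ∀ n → certificate n (suc (suc n)) ≡ 0
certificate-vanishes n = begin
  Q * summand n (suc n) ≡⟨ cong (Q *_) (summand-vanishes n) ⟩
  Q * 0                 ≡⟨ *-zeroʳ Q ⟩
  0                     ∎
  where Q = certificateFactor n (n ∸ suc n) * suc (2 * n + suc n)

certificate-as-summand : ∀ {n} k m → k + m ≡ n →
                         suc m * suc m * certificate n k
                           ≡ certificateFactor n (suc m) * (k * k * k) * summand n k
certificate-as-summand {n} zero m _ = begin
  suc m * suc m * 0                      ≡⟨ *-zeroʳ (suc m * suc m) ⟩
  0                                      ≡⟨ *-zeroˡ (summand n 0) ⟨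
  0 * summand n 0                        ≡⟨ cong (_* summand n 0) (*-zeroʳ (certificateFactor n (suc m))) ⟨
  certificateFactor n (suc m) * 0 * summand n 0 ∎
certificate-as-summand (suc k) m refl = begin
  suc m * suc m * (certificateFactor n (n ∸ k) * suc N * summand n k)
    ≡⟨ cong (λ r → suc m * suc m * (certificateFactor n r * suc N * summand n k)) n∸k≡1+m ⟩
  suc m * suc m * (Q * suc N * summand n k)
    ≡⟨ regroup (suc m) Q (suc N) (summand n k) ⟩
  Q * (suc N * (suc m * suc m) * summand n k)
    ≡⟨ cong (Q *_) (summand-suc-k k m refl) ⟨
  Q * (suc k * suc k * suc k * summand n (suc k))
    ≡⟨ *-assoc Q (suc k * suc k * suc k) (summand n (suc k)) ⟨
  Q * (suc k * suc k * suc k) * summand n (suc k) ∎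
  where
  n = suc (k + m)
  N = 2 * n + k
  Q = certificateFactor n (suc m)
  n∸k≡1+m : n ∸ k ≡ suc m
  n∸k≡1+m = trans (+-∸-assoc 1 (m≤m+n k m)) (cong suc (m+n∸m≡n k m))
  regroup : ∀ s q a t → s * s * (q * a * t) ≡ q * (a * (s * s) * t)
  regroup = solve-∀

telescoping-step-interior : ∀ {n} k m → k + m ≡ n →
  suc n * suc n * suc n * summand (suc n) k + certificate n (suc k)
    ≡ 8 * ((1 + 2 * n) * (1 + 2 * n) * (1 + 2 * n)) * summand n k + certificate n k
telescoping-step-interior k m refl = *-cancelˡ-≡ _ _ (suc m * suc m) (begin
  s * (c * summand (suc n) k + certificateFactor n (n ∸ k) * suc N * T)
    ≡⟨ *-distribˡ-+ s (c * summand (suc n) k) _ ⟩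
  s * (c * summand (suc n) k) + s * (certificateFactor n (n ∸ k) * suc N * T)
    ≡⟨ cong₂ (λ x r → x + s * (certificateFactor n r * suc N * T))
             (x*yz≡y*xz s c (summand (suc n) k)) (m+n∸m≡n k m) ⟩
  c * (s * summand (suc n) k) + s * (certificateFactor n m * suc N * T)
    ≡⟨ cong (λ x → c * x + s * (certificateFactor n m * suc N * T)) (summand-suc-n k m refl) ⟩
  c * ((2 + N) * (1 + N) * T) + s * (certificateFactor n m * suc N * T)
    ≡⟨ zeilberger k m T ⟩
  s * (d * T) + certificateFactor n (suc m) * (k * k * k) * T
    ≡⟨ cong (s * (d * T) +_) (certificate-as-summand k m refl) ⟨
  s * (d * T) + s * certificate n k
    ≡⟨ *-distribˡ-+ s (d * T) (certificate n k) ⟨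
  s * (d * T + certificate n k) ∎)
  where
  n = k + m
  N = 2 * n + k
  s = suc m * suc m
  c = suc n * suc n * suc n
  d = 8 * ((1 + 2 * n) * (1 + 2 * n) * (1 + 2 * n))
  T = summand n k
  zeilberger : ∀ k m t →
    (1 + (k + m)) * (1 + (k + m)) * (1 + (k + m)) * ((2 + (2 * (k + m) + k)) * (1 + (2 * (k + m) + k)) * t)
    + (1 + m) * (1 + m) * (((3 * (k + m) + 2) * (3 * (k + m) + 3) + (21 * (k + m) + 13) * m) * (1 + (2 * (k + m) + k)) * t)
    ≡ (1 + m) * (1 + m) * (8 * ((1 + 2 * (k + m)) * (1 + 2 * (k + m)) * (1 + 2 * (k + m))) * t)
    + ((3 * (k + m) + 2) * (3 * (k + m) + 3) + (21 * (k + m) + 13) * (1 + m)) * (k * k * k) * t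
  zeilberger = solve-∀

telescoping-step-last : ∀ n →
  suc n * suc n * suc n * summand (suc n) (suc n) + certificate n (suc (suc n))
    ≡ 8 * ((1 + 2 * n) * (1 + 2 * n) * (1 + 2 * n)) * summand n (suc n) + certificate n (suc n)
telescoping-step-last n = begin
  c * summand (suc n) (suc n) + certificate n (suc (suc n))
    ≡⟨ cong (c * summand (suc n) (suc n) +_) (certificate-vanishes n) ⟩
  c * summand (suc n) (suc n) + 0
    ≡⟨ +-identityʳ _ ⟩
  c * summand (suc n) (suc n)
    ≡⟨ summand-suc-k n 0 (+-identityʳ n) ⟩
  (1 + M) * 1 * summand (suc n) n
    ≡⟨ *-assoc (1 + M) 1 (summand (suc n) n) ⟩
  (1 + M) * (1 * summand (suc n) n)
    ≡⟨ cong ((1 + M) *_) (summand-suc-n n 0 (+-identityʳ n)) ⟩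
  (1 + M) * ((2 + N) * (1 + N) * summand n n)
    ≡⟨ zeilberger n (summand n n) ⟩
  certificateFactor n 0 * suc N * summand n n
    ≡⟨ cong (λ r → certificateFactor n r * suc N * summand n n) (n∸n≡0 n) ⟨
  certificate n (suc n)
    ≡⟨ cong (_+ certificate n (suc n)) (trans (cong (d *_) (summand-vanishes n)) (*-zeroʳ d)) ⟨
  d * summand n (suc n) + certificate n (suc n) ∎
  where
  M = 2 * suc n + n
  N = 2 * n + n
  c = suc n * suc n * suc n
  d = 8 * ((1 + 2 * n) * (1 + 2 * n) * (1 + 2 * n))
  zeilberger : ∀ n t → (1 + (2 * suc n + n)) * ((2 + (2 * n + n)) * (1 + (2 * n + n)) * t)
                       ≡ ((3 * n + 2) * (3 * n + 3) + (21 * n + 13) * 0) * suc (2 * n + n) * t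
  zeilberger = solve-∀

telescoping-step : ∀ n k → k ≤ suc n →
  suc n * suc n * suc n * summand (suc n) k + certificate n (suc k)
    ≡ 8 * ((1 + 2 * n) * (1 + 2 * n) * (1 + 2 * n)) * summand n k + certificate n k
telescoping-step n k k≤1+n with m≤n⇒m<n∨m≡n k≤1+n
... | inj₂ refl = telescoping-step-last n
... | inj₁ (s≤s k≤n) with m≤n⇒∃[o]m+o≡n k≤n
...   | m , k+m≡n = telescoping-step-interior k m k+m≡n

sum-recurrence : ∀ n →
  suc n * suc n * suc n * sumTo (suc n) (summand (suc n))
    ≡ 8 * ((1 + 2 * n) * (1 + 2 * n) * (1 + 2 * n)) * sumTo n (summand n)
sum-recurrence n = begin
  c * sumTo (suc n) (summand (suc n))
    ≡⟨ *-distribˡ-sumTo c (suc n) (summand (suc n)) ⟩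
  sumTo (suc n) a
    ≡⟨ +-identityʳ _ ⟨
  sumTo (suc n) a + 0
    ≡⟨ cong (sumTo (suc n) a +_) (certificate-vanishes n) ⟨
  sumTo (suc n) a + certificate n (suc (suc n))
    ≡⟨ sumTo-telescope (suc n) a b (certificate n) refl (telescoping-step n) ⟩
  sumTo n b + d * summand n (suc n)
    ≡⟨ cong (λ x → sumTo n b + x) (trans (cong (d *_) (summand-vanishes n)) (*-zeroʳ d)) ⟩
  sumTo n b + 0
    ≡⟨ +-identityʳ _ ⟩
  sumTo n b
    ≡⟨ *-distribˡ-sumTo d n (summand n) ⟨
  d * sumTo n (summand n) ∎
  where
  c = suc n * suc n * suc n
  d = 8 * ((1 + 2 * n) * (1 + 2 * n) * (1 + 2 * n))
  a b : ℕ → ℕ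
  a k = c * summand (suc n) k
  b k = d * summand n k

centralBinomial-suc : ∀ n → suc n * ((2 * suc n) C suc n) ≡ 2 * (1 + 2 * n) * ((2 * n) C n)
centralBinomial-suc n = *-cancelʳ-≡ _ _ (suc n * (n ! * n !)) {{m*n≢0 (suc n) (n ! * n !) {{_}} {{n !* n !≢0}}}} (begin
  suc n * B′ * (suc n * (n ! * n !))
    ≡⟨ regroup (suc n) B′ (n !) ⟩
  B′ * (suc n ! * suc n !)
    ≡⟨ nCk*k!*m!≡n! (suc n) (suc n) (n+n≡2n (suc n)) ⟩
  (2 * suc n) !
    ≡⟨ cong _! (2[1+n]≡2+2n n) ⟩
  (2 + 2 * n) * ((1 + 2 * n) * (2 * n) !)
    ≡⟨ cong (λ x → (2 + 2 * n) * ((1 + 2 * n) * x)) (nCk*k!*m!≡n! n n (n+n≡2n n)) ⟨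
  (2 + 2 * n) * ((1 + 2 * n) * (B * (n ! * n !)))
    ≡⟨ regroup′ n B (n ! * n !) ⟩
  2 * (1 + 2 * n) * B * (suc n * (n ! * n !)) ∎)
  where
  B = (2 * n) C n
  B′ = (2 * suc n) C suc n
  regroup : ∀ s b x → s * b * (s * (x * x)) ≡ b * (s * x * (s * x))
  regroup = solve-∀
  n+n≡2n : ∀ n → n + n ≡ 2 * n
  n+n≡2n = solve-∀
  2[1+n]≡2+2n : ∀ n → 2 * suc n ≡ 2 + 2 * n
  2[1+n]≡2+2n = solve-∀
  regroup′ : ∀ n b w → (2 + 2 * n) * ((1 + 2 * n) * (b * w)) ≡ 2 * (1 + 2 * n) * b * (suc n * w)
  regroup′ = solve-∀

centralBinomial³-recurrence : ∀ n →
  suc n * suc n * suc n * ((2 * suc n) C suc n) ^ 3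
    ≡ 8 * ((1 + 2 * n) * (1 + 2 * n) * (1 + 2 * n)) * ((2 * n) C n) ^ 3
centralBinomial³-recurrence n = begin
  suc n * suc n * suc n * ((2 * suc n) C suc n) ^ 3
    ≡⟨ cube-of-product (suc n) ((2 * suc n) C suc n) ⟩
  (suc n * ((2 * suc n) C suc n)) ^ 3
    ≡⟨ cong (_^ 3) (centralBinomial-suc n) ⟩
  (2 * (1 + 2 * n) * ((2 * n) C n)) ^ 3
    ≡⟨ cube-of-product (2 * (1 + 2 * n)) ((2 * n) C n) ⟨
  2 * (1 + 2 * n) * (2 * (1 + 2 * n)) * (2 * (1 + 2 * n)) * ((2 * n) C n) ^ 3
    ≡⟨ cong (_* ((2 * n) C n) ^ 3) (cube-of-double (1 + 2 * n)) ⟩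
  8 * ((1 + 2 * n) * (1 + 2 * n) * (1 + 2 * n)) * ((2 * n) C n) ^ 3 ∎
  where
  cube-of-product : ∀ a b → a * a * a * (b * (b * (b * 1))) ≡ a * b * (a * b * (a * b * 1))
  cube-of-product = solve-∀
  cube-of-double : ∀ a → 2 * a * (2 * a) * (2 * a) ≡ 8 * (a * a * a)
  cube-of-double = solve-∀

mainTheorem6 : ∀ (n : ℕ) →
    sumTo n (λ k → ((n C k) ^ 2) * ((n + k) C n) * ((2 * n + k) C n))
      ≡ ((2 * n) C n) ^ 3
mainTheorem6 zero    = refl
mainTheorem6 (suc n) = *-cancelˡ-≡ _ _ (suc n * suc n * suc n) (begin
  suc n * suc n * suc n * sumTo (suc n) (summand (suc n))
    ≡⟨ sum-recurrence n ⟩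
  8 * ((1 + 2 * n) * (1 + 2 * n) * (1 + 2 * n)) * sumTo n (summand n)
    ≡⟨ cong (8 * ((1 + 2 * n) * (1 + 2 * n) * (1 + 2 * n)) *_) (mainTheorem6 n) ⟩
  8 * ((1 + 2 * n) * (1 + 2 * n) * (1 + 2 * n)) * ((2 * n) C n) ^ 3
    ≡⟨ centralBinomial³-recurrence n ⟨
  suc n * suc n * suc n * ((2 * suc n) C suc n) ^ 3 ∎)
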